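{- Let $H=(A,B,E)$ be a connected bipartite graph and write $\widetilde{T}_H(x,y)=\sum_{i,j}t_{i,j}(H)x^iy^j$. If $t_{i,j}(H)>0$ for some $i,j$, then $t_{i',j'}(H)>0$ for all integers $0\le i'\leq i$, $0\le j'\leq j$ with $(i',j')\neq (0,0)$.
   Context: A bipartite graph $H=(A,B,E)$ comes with designated sides $A,B$. For $m=|V(H)|$ and a permutation $\pi$ of $V(H)$ (a bijection to $[m]$), a vertex $i\in A$ is internally active if $\pi(i)>\pi(j)$ for all neighbours $j$ of $i$, and $j\in B$ is externally active if $\pi(j)>\pi(i)$ for all neighbours $i$ of $j$; $\mathrm{ia}(\pi),\mathrm{ea}(\pi)$ are their numbers, and $\widetilde{T}_H(x,y)=\frac{1}{m!}\sum_{\pi}x^{\mathrm{ia}(\pi)}y^{\mathrm{ea}(\pi)}$. -}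

module Defs where

open import Data.Nat using (ℕ; _+_)
open import Data.Fin using (Fin; _<_)
open import Data.Fin.Properties using (all?; _<?_)
open import Data.Bool using (Bool; T)
open import Data.Bool.Properties using (T?)
open import Data.Sum using (_⊎_; inj₁; inj₂)
open import Data.Product using (Σ; _×_; _,_)
open import Data.List using (List; length; filter)
open import Data.List.Base using () renaming (allFin to allFinL)
open import Data.Empty using (⊥)
open import Relation.Binary.PropositionalEquality using (_≡_)
open import Relation.Binary.Construct.Closure.ReflexiveTransitive using (Star)
open import Relation.Nullary.Decidable using (Dec; _→-dec_)
open import Function.Bundles using (Bijection; _⤖_)
open Bijection using (to)

-- A bipartite graph H = (A, B, E) with A = Fin a, B = Fin b, and
-- E a j = true  iff  i ∈ A and j ∈ B are adjacent.
BipGraph : ℕ → ℕ → Set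
BipGraph a b = Fin a → Fin b → Bool

Vertex : ℕ → ℕ → Set
Vertex a b = Fin a ⊎ Fin b

Adj : ∀ {a b} → BipGraph a b → Vertex a b → Vertex a b → Set
Adj E (inj₁ i) (inj₁ i′) = ⊥
Adj E (inj₁ i) (inj₂ j) = T (E i j)
Adj E (inj₂ j) (inj₁ i) = T (E i j)
Adj E (inj₂ j) (inj₂ j′) = ⊥

Connected : ∀ {a b} → BipGraph a b → Set
Connected E = ∀ u v → Star (Adj E) u v

Perm : ℕ → ℕ → Set
Perm a b = Vertex a b ⤖ Fin (a + b)

module _ {a b : ℕ} (E : BipGraph a b) (π : Perm a b) where

  IntActive : Fin a → Set
  IntActive i = ∀ j → T (E i j) → to π (inj₂ j) < to π (inj₁ i)

  ExtActive : Fin b → Set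
  ExtActive j = ∀ i → T (E i j) → to π (inj₁ i) < to π (inj₂ j)

  intActive? : ∀ i → Dec (IntActive i)
  intActive? i = all? (λ j → T? (E i j) →-dec (to π (inj₂ j) <? to π (inj₁ i)))

  extActive? : ∀ j → Dec (ExtActive j)
  extActive? j = all? (λ i → T? (E i j) →-dec (to π (inj₁ i) <? to π (inj₂ j)))

  ia : ℕ
  ia = length (filter intActive? (allFinL a))

  ea : ℕ
  ea = length (filter extActive? (allFinL b))

-- t_{i,j}(H) = #{π : ia(π) = i, ea(π) = j} / m!, so t_{i,j}(H) > 0 iff
-- some permutation π has ia(π) = i and ea(π) = j.
tPositive : ∀ {a b} → BipGraph a b → ℕ → ℕ → Set
tPositive {a} {b} E i j = Σ (Perm a b) (λ π → ia E π ≡ i × ea E π ≡ j)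

-- The internally active vertices of A and the externally active vertices of B are
-- exactly the local maxima of π on the graph H, so together they form an independent
-- set. Conversely, in a connected graph every nonempty independent set S is the set of
-- local maxima of some π: list the vertices by decreasing distance from S. A vertex of
-- S then beats its neighbours, which lie outside S and so are farther away, while any
-- other vertex has a neighbour closer to S that comes later. Shrinking the two active
-- sets of a permutation counted by t_{i,j} to sizes i′ and j′ keeps them independent,
-- and they stay nonempty as long as (i′, j′) ≠ (0, 0).

module Submission where

open import Level using (0ℓ)
open import Data.Nat using (ℕ; zero; suc; _≤_; _<_; _>_; z≤n; s≤s)
open import Data.Nat.Properties as ℕ using (n≤0⇒n≡0; 1+n≰n; <-asym; n<1+n; n≢0⇒n>0)
open import Data.Fin as F using (Fin; fromℕ<; punchOut; join; splitAt)
open import Data.Fin.Properties as FP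
  using (any?; pigeonhole; punchOut-injective; toℕ-fromℕ<; +↔⊎; splitAt-join)
open import Data.Fin.Subset using (Subset; inside; outside; _∈_; _⊆_; _⊂_; ∣_∣; ⊥; Nonempty)
open import Data.Fin.Subset.Properties
  using (_∈?_; drop-there; out⊆; s⊆s; ⊥⊆; ∈⊤; ∣⊥∣≡0; ∣⊤∣≡n; p⊂q⇒∣p∣<∣q∣; nonempty?; Empty-unique)
open import Data.Vec using ([]; _∷_; tabulate; here; there)
open import Data.Bool using (T)
open import Data.Bool.Properties using (T?)
open import Data.Sum using (_⊎_; inj₁; inj₂; [_,_]; [_,_]′)
open import Data.Product using (_×_; _,_; ∃; proj₁; proj₂)
open import Data.Product.Relation.Binary.Lex.Strict using (×-Lex; ×-transitive; ×-compare)
import Data.List as List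
open import Data.List using (length; filter)
open import Function using (_∘_; id; flip)
open import Function.Bundles using (Bijection; _⤖_; mk⤖; _⇔_; mk⇔; Equivalence)
open import Function.Definitions using (Injective; Surjective)
open import Function.Construct.Composition using (_⤖-∘_; _⇔-∘_)
open import Function.Construct.Symmetry using (⇔-sym)
open import Function.Properties.Inverse using (↔⇒⤖; ↔-sym)
open import Relation.Unary using (Pred; Decidable)
import Relation.Binary as B
open import Relation.Binary using (Rel; Transitive; Trichotomous; tri<; tri≈; tri>)
open import Relation.Binary.Consequences using (tri⇒irr; tri⇒dec<)
import Relation.Binary.Construct.Flip.EqAndOrd as Flip
open import Relation.Binary.Construct.Closure.ReflexiveTransitive using (Star; ε; _◅_)
open import Relation.Binary.PropositionalEquality
  using (_≡_; _≢_; refl; sym; trans; cong; subst; subst₂; resp₂; isEquivalence)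
open import Relation.Nullary using (Dec; yes; no; does; ¬_; contradiction)
open import Relation.Nullary.Decidable as Dec using (_×-dec_; _⊎-dec_; decidable-stable)

open import Defs

open Equivalence using (to; from)

private
  variable
    n : ℕ

subsetOf : ∀ {p} {P : Pred (Fin n) p} → Decidable P → Subset n
subsetOf P? = tabulate (does ∘ P?)

∈-subsetOf : ∀ {p} {P : Pred (Fin n) p} (P? : Decidable P) → ∀ x → x ∈ subsetOf P? ⇔ P x
∈-subsetOf P? F.zero with P? F.zero
... | yes p = mk⇔ (λ _ → p) (λ _ → here)
... | no ¬p = mk⇔ (λ ()) (λ p → contradiction p ¬p)
∈-subsetOf P? (F.suc x) = mk⇔ (to ih ∘ drop-there) (there ∘ from ih)
  where ih = ∈-subsetOf (P? ∘ F.suc) x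

∈-tail : ∀ (Q : Pred (Fin (suc n)) 0ℓ) {s} {p : Subset n} →
  (∀ x → x ∈ s ∷ p ⇔ Q x) → ∀ x → x ∈ p ⇔ Q (F.suc x)
∈-tail Q s∷p⇔Q x = mk⇔ (to (s∷p⇔Q (F.suc x)) ∘ there) (drop-there ∘ from (s∷p⇔Q (F.suc x)))

length-filter-tabulate : {A : Set} {P : Pred A 0ℓ} (P? : Decidable P) (g : Fin n → A) →
  {p : Subset n} → (∀ x → x ∈ p ⇔ P (g x)) → length (filter P? (List.tabulate g)) ≡ ∣ p ∣
length-filter-tabulate P? g {[]} _ = refl
length-filter-tabulate {P = P} P? g {inside ∷ p} p⇔P with P? (g F.zero)
... | yes _ = cong suc (length-filter-tabulate P? (g ∘ F.suc) (∈-tail (P ∘ g) p⇔P))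
... | no ¬Pg₀ = contradiction (to (p⇔P F.zero) here) ¬Pg₀
length-filter-tabulate {P = P} P? g {outside ∷ p} p⇔P with P? (g F.zero)
... | yes Pg₀ = contradiction (from (p⇔P F.zero) Pg₀) λ ()
... | no _ = length-filter-tabulate P? (g ∘ F.suc) (∈-tail (P ∘ g) p⇔P)

length-filter-allFin : {P : Pred (Fin n) 0ℓ} (P? : Decidable P) {p : Subset n} →
  (∀ x → x ∈ p ⇔ P x) → length (filter P? (List.allFin n)) ≡ ∣ p ∣
length-filter-allFin P? = length-filter-tabulate P? id

subset-of-size : ∀ {m} (p : Subset n) → m ≤ ∣ p ∣ → ∃ λ q → q ⊆ p × ∣ q ∣ ≡ m
subset-of-size [] z≤n = [] , id , refl
subset-of-size (outside ∷ p) m≤∣p∣ with q , q⊆p , ∣q∣≡m ← subset-of-size p m≤∣p∣ =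
  outside ∷ q , out⊆ q⊆p , ∣q∣≡m
subset-of-size {suc k} {zero} (inside ∷ p) _ = ⊥ , ⊥⊆ , ∣⊥∣≡0 (suc k)
subset-of-size {suc _} {suc m} (inside ∷ p) (s≤s m≤∣p∣)
  with q , q⊆p , ∣q∣≡m ← subset-of-size p m≤∣p∣ =
  inside ∷ q , s⊆s q⊆p , cong suc ∣q∣≡m

∣p∣≢0⇒nonempty : ∀ {n} (p : Subset n) → ∣ p ∣ ≢ 0 → Nonempty p
∣p∣≢0⇒nonempty {n} p ∣p∣≢0 with nonempty? p
... | yes ne = ne
... | no empty = contradiction (trans (cong ∣_∣ (Empty-unique empty)) (∣⊥∣≡0 n)) ∣p∣≢0

nonempty-either : ∀ {m n} (p : Subset m) (q : Subset n) →
  ¬ (∣ p ∣ ≡ 0 × ∣ q ∣ ≡ 0) → Nonempty p ⊎ Nonempty q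
nonempty-either p q ¬both with ∣ p ∣ ℕ.≟ 0
... | no ∣p∣≢0 = inj₁ (∣p∣≢0⇒nonempty p ∣p∣≢0)
... | yes ∣p∣≡0 = inj₂ (∣p∣≢0⇒nonempty q (¬both ∘ (∣p∣≡0 ,_)))

injective⇒surjective : {f : Fin n → Fin n} → Injective _≡_ _≡_ f → Surjective _≡_ _≡_ f
injective⇒surjective {suc n} {f} f-inj y with any? (λ x → f x FP.≟ y)
... | yes (x , fx≡y) = x , λ { refl → fx≡y }
... | no ∄x
  -- y is missed, so punching it out leaves an injection of Fin (suc n) into Fin n
  with i , j , i<j , pᵢ≡pⱼ ← pigeonhole (n<1+n n) (λ x → punchOut {i = y} (∄x ∘ (x ,_) ∘ sym)) =
  contradiction (f-inj (punchOut-injective {i = y} _ _ pᵢ≡pⱼ)) (FP.<⇒≢ i<j)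

module Rank {ℓ} {_≺_ : Rel (Fin n) ℓ}
  (≺-trans : Transitive _≺_) (≺-cmp : Trichotomous _≡_ _≺_) where

  below : Fin n → Subset n
  below x = subsetOf (λ y → tri⇒dec< ≺-cmp y x)

  ∈-below : ∀ {x} y → y ∈ below x ⇔ y ≺ x
  ∈-below {x} = ∈-subsetOf (λ y → tri⇒dec< ≺-cmp y x)

  private
    irrefl : ∀ {x} → ¬ x ≺ x
    irrefl = tri⇒irr ≺-cmp refl

  below⊂below : ∀ {x y} → x ≺ y → below x ⊂ below y
  below⊂below {x} {y} x≺y =
    (λ {z} z∈ → from (∈-below z) (≺-trans (to (∈-below z) z∈) x≺y)) ,
    x , from (∈-below x) x≺y , irrefl ∘ to (∈-below x)

  ∣below∣<n : ∀ x → ∣ below x ∣ < n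
  ∣below∣<n x = subst (∣ below x ∣ <_) (∣⊤∣≡n n)
    (p⊂q⇒∣p∣<∣q∣ ((λ _ → ∈⊤) , x , ∈⊤ , irrefl ∘ to (∈-below x)))

  rank : Fin n → Fin n
  rank x = fromℕ< (∣below∣<n x)

  rank-mono : ∀ {x y} → x ≺ y → rank x F.< rank y
  rank-mono {x} {y} x≺y =
    subst₂ _<_ (sym (toℕ-fromℕ< (∣below∣<n x))) (sym (toℕ-fromℕ< (∣below∣<n y)))
      (p⊂q⇒∣p∣<∣q∣ (below⊂below x≺y))

  rank-injective : Injective _≡_ _≡_ rank
  rank-injective {x} {y} rx≡ry with ≺-cmp x y
  ... | tri< x≺y _ _ = contradiction rx≡ry (FP.<⇒≢ (rank-mono x≺y))
  ... | tri≈ _ x≡y _ = x≡y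
  ... | tri> _ _ y≺x = contradiction (sym rx≡ry) (FP.<⇒≢ (rank-mono y≺x))

  rank⤖ : Fin n ⤖ Fin n
  rank⤖ = mk⤖ (rank-injective , injective⇒surjective rank-injective)

module HeightOrder (h : Fin n → ℕ) where

  _≺_ : Rel (Fin n) 0ℓ
  x ≺ y = ×-Lex _≡_ _>_ F._<_ (h x , x) (h y , y)

  ≺-trans : Transitive _≺_
  ≺-trans = ×-transitive {_<₁_ = _>_} {_<₂_ = F._<_}
    isEquivalence (resp₂ _>_) (flip ℕ.<-trans) FP.<-trans

  ≺-cmp : Trichotomous _≡_ _≺_
  ≺-cmp x y with ×-compare sym (Flip.compare _<_ ℕ.<-cmp) FP.<-cmp (h x , x) (h y , y)
  ... | tri< x≺y x≉y x⊁y = tri< x≺y (x≉y ∘ λ { refl → refl , refl }) x⊁y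
  ... | tri≈ x⊀y (_ , x≡y) x⊁y = tri≈ x⊀y x≡y x⊁y
  ... | tri> x⊀y x≉y x≻y = tri> x⊀y (x≉y ∘ λ { refl → refl , refl }) x≻y

decreasingHeightPerm : ∀ {a b} (h : Vertex a b → ℕ) →
  ∃ λ (π : Perm a b) → ∀ {u v} → h u < h v → Bijection.to π v F.< Bijection.to π u
decreasingHeightPerm {a} {b} h = rank⤖ ⤖-∘ ↔⇒⤖ (↔-sym +↔⊎) , rank-mono ∘ inj₁ ∘ h-splitAt-join
  where
  open HeightOrder (h ∘ splitAt a)
  open Rank ≺-trans ≺-cmp
  h-splitAt-join : ∀ {u v} → h u < h v → h (splitAt a (join a b u)) < h (splitAt a (join a b v))
  h-splitAt-join {u} {v} =
    subst₂ (λ u′ v′ → h u′ < h v′) (sym (splitAt-join a b u)) (sym (splitAt-join a b v))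

least-witness : ∀ {q} {Q : Pred ℕ q} → Decidable Q → ∀ {m} → Q m →
  ∃ λ k → Q k × (∀ {j} → Q j → k ≤ j)
least-witness Q? {zero} Qm = zero , Qm , λ _ → z≤n
least-witness {Q = Q} Q? {suc m} Qm with Q? zero
... | yes Q₀ = zero , Q₀ , λ _ → z≤n
... | no ¬Q₀ with k , Qk , k-min ← least-witness (Q? ∘ suc) Qm = suc k , Qk , suc-min
  where
  suc-min : ∀ {j} → Q j → suc k ≤ j
  suc-min {zero} Q₀ = contradiction Q₀ ¬Q₀
  suc-min {suc j} Qj = s≤s (k-min Qj)

module Distance {V : Set} {_∼_ : Rel V 0ℓ} (_∼?_ : B.Decidable _∼_)
  (search : ∀ {P : Pred V 0ℓ} → Decidable P → Dec (∃ P))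
  {S : Pred V 0ℓ} (S? : Decidable S) (reaches-S : ∀ v → ∃ λ u → S u × Star _∼_ v u) where

  Within : ℕ → Pred V 0ℓ
  Within zero = S
  Within (suc k) v = Within k v ⊎ ∃ λ u → v ∼ u × Within k u

  within? : ∀ k → Decidable (Within k)
  within? zero = S?
  within? (suc k) v = within? k v ⊎-dec search (λ u → (v ∼? u) ×-dec within? k u)

  walk⇒within : ∀ {v u} → Star _∼_ v u → S u → ∃ λ k → Within k v
  walk⇒within ε Su = zero , Su
  walk⇒within (v∼w ◅ w⇝u) Su with k , Wk ← walk⇒within w⇝u Su = suc k , inj₂ (_ , v∼w , Wk)

  shortest : ∀ v → ∃ λ k → Within k v × (∀ {j} → Within j v → k ≤ j)
  shortest v with u , Su , v⇝u ← reaches-S v =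
    least-witness (λ k → within? k v) (proj₂ (walk⇒within v⇝u Su))

  dist : V → ℕ
  dist v = proj₁ (shortest v)

  dist≡0⇔S : ∀ v → dist v ≡ 0 ⇔ S v
  dist≡0⇔S v with shortest v
  ... | k , Wk , k-min = mk⇔ (λ { refl → Wk }) (λ Sv → n≤0⇒n≡0 (k-min Sv))

  dist-descent : ∀ v → dist v ≢ 0 → ∃ λ u → v ∼ u × dist u < dist v
  dist-descent v d≢0 with shortest v
  ... | zero , _ , _ = contradiction refl d≢0
  ... | suc k , inj₁ Wk , k-min = contradiction (k-min Wk) 1+n≰n
  ... | suc k , inj₂ (u , v∼u , Wk) , _ = u , v∼u , s≤s (proj₂ (proj₂ (shortest u)) Wk)

LocalMax : ∀ {V : Set} {m} → Rel V 0ℓ → (V → Fin m) → Pred V 0ℓ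
LocalMax _∼_ π v = ∀ u → v ∼ u → π u F.< π v

module _ {V : Set} {_∼_ : Rel V 0ℓ} (h : V → ℕ)
  (descent : ∀ v → h v ≢ 0 → ∃ λ u → v ∼ u × h u < h v)
  (zeros-independent : ∀ {v u} → v ∼ u → h v ≡ 0 → h u ≢ 0)
  {m} {π : V → Fin m} (π-antitone : ∀ {u v} → h u < h v → π v F.< π u) where

  localMax⇔height≡0 : ∀ v → LocalMax _∼_ π v ⇔ h v ≡ 0
  localMax⇔height≡0 v = mk⇔ localMax⇒0 (λ hv≡0 u v∼u → π-antitone (h<h v∼u hv≡0))
    where
    h<h : ∀ {u} → v ∼ u → h v ≡ 0 → h v < h u
    h<h {u} v∼u hv≡0 = subst (_< h u) (sym hv≡0) (n≢0⇒n>0 (zeros-independent v∼u hv≡0))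
    localMax⇒0 : LocalMax _∼_ π v → h v ≡ 0
    localMax⇒0 max = decidable-stable (h v ℕ.≟ 0) λ hv≢0 →
      let u , v∼u , hu<hv = descent v hv≢0 in <-asym (π-antitone hu<hv) (max u v∼u)

module _ {a b : ℕ} (E : BipGraph a b) where

  adj? : B.Decidable (Adj E)
  adj? (inj₁ _) (inj₁ _) = no λ ()
  adj? (inj₁ i) (inj₂ j) = T? (E i j)
  adj? (inj₂ j) (inj₁ i) = T? (E i j)
  adj? (inj₂ _) (inj₂ _) = no λ ()

  searchVertex : ∀ {P : Pred (Vertex a b) 0ℓ} → Decidable P → Dec (∃ P)
  searchVertex P? = Dec.map′ [ (λ (i , p) → inj₁ i , p) , (λ (j , p) → inj₂ j , p) ]′
    (λ { (inj₁ i , p) → inj₁ (i , p) ; (inj₂ j , p) → inj₂ (j , p) })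
    (any? (P? ∘ inj₁) ⊎-dec any? (P? ∘ inj₂))

  module _ (π : Perm a b) where

    intActive⇔localMax : ∀ i → IntActive E π i ⇔ LocalMax (Adj E) (Bijection.to π) (inj₁ i)
    intActive⇔localMax i = mk⇔ (λ { act (inj₂ j) e → act j e }) (λ max j → max (inj₂ j))

    extActive⇔localMax : ∀ j → ExtActive E π j ⇔ LocalMax (Adj E) (Bijection.to π) (inj₂ j)
    extActive⇔localMax j = mk⇔ (λ { act (inj₁ i) e → act i e }) (λ max i → max (inj₁ i))

    ia≡∣p∣ : ∀ {p : Subset a} → (∀ i → i ∈ p ⇔ IntActive E π i) → ia E π ≡ ∣ p ∣
    ia≡∣p∣ = length-filter-allFin (intActive? E π)

    ea≡∣p∣ : ∀ {p : Subset b} → (∀ j → j ∈ p ⇔ ExtActive E π j) → ea E π ≡ ∣ p ∣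
    ea≡∣p∣ = length-filter-allFin (extActive? E π)

    intActiveSet : Subset a
    intActiveSet = subsetOf (intActive? E π)

    extActiveSet : Subset b
    extActiveSet = subsetOf (extActive? E π)

    ∣intActiveSet∣ : ∣ intActiveSet ∣ ≡ ia E π
    ∣intActiveSet∣ = sym (ia≡∣p∣ (∈-subsetOf (intActive? E π)))

    ∣extActiveSet∣ : ∣ extActiveSet ∣ ≡ ea E π
    ∣extActiveSet∣ = sym (ea≡∣p∣ (∈-subsetOf (extActive? E π)))

    activeSets-nonadjacent : ∀ {i j} → i ∈ intActiveSet → j ∈ extActiveSet → ¬ T (E i j)
    activeSets-nonadjacent {i} {j} i∈ j∈ e =
      <-asym (to (∈-subsetOf (intActive? E π) i) i∈ j e)
             (to (∈-subsetOf (extActive? E π) j) j∈ i e)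

  localMaxima-realisable : Connected E → ∀ {S : Pred (Vertex a b) 0ℓ} → Decidable S →
    (∀ {u v} → Adj E u v → S u → ¬ S v) → ∃ S →
    ∃ λ (π : Perm a b) → ∀ v → LocalMax (Adj E) (Bijection.to π) v ⇔ S v
  localMaxima-realisable conn {S} S? S-independent (s , Ss) =
    π , λ v → dist≡0⇔S v ⇔-∘ localMax⇔height≡0 dist dist-descent zeros-independent π-antitone v
    where
    open Distance adj? searchVertex S? (λ v → s , Ss , conn v s)
    zeros-independent : ∀ {v u} → Adj E v u → dist v ≡ 0 → dist u ≢ 0
    zeros-independent {v} {u} v∼u dv≡0 du≡0 =
      S-independent v∼u (to (dist≡0⇔S v) dv≡0) (to (dist≡0⇔S u) du≡0)
    π : Perm a b
    π = proj₁ (decreasingHeightPerm dist)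
    π-antitone : ∀ {u v} → dist u < dist v → Bijection.to π v F.< Bijection.to π u
    π-antitone = proj₂ (decreasingHeightPerm dist)

  nonadjacent-sets-tPositive : Connected E → (A : Subset a) (B : Subset b) →
    (∀ {i j} → i ∈ A → j ∈ B → ¬ T (E i j)) → Nonempty A ⊎ Nonempty B →
    tPositive E ∣ A ∣ ∣ B ∣
  nonadjacent-sets-tPositive conn A B A-B-nonadjacent nonempty =
    π , ia≡∣p∣ π (λ i → ⇔-sym (localMax⇔S (inj₁ i) ⇔-∘ intActive⇔localMax π i))
      , ea≡∣p∣ π (λ j → ⇔-sym (localMax⇔S (inj₂ j) ⇔-∘ extActive⇔localMax π j))
    where
    S : Pred (Vertex a b) 0ℓ
    S = [ _∈ A , _∈ B ]′
    S-independent : ∀ {u v} → Adj E u v → S u → ¬ S v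
    S-independent {inj₁ _} {inj₂ _} e i∈A j∈B = A-B-nonadjacent i∈A j∈B e
    S-independent {inj₂ _} {inj₁ _} e j∈B i∈A = A-B-nonadjacent i∈A j∈B e
    S-nonempty : ∃ S
    S-nonempty = [ (λ (i , i∈A) → inj₁ i , i∈A) , (λ (j , j∈B) → inj₂ j , j∈B) ]′ nonempty
    realised : ∃ λ (π : Perm a b) → ∀ v → LocalMax (Adj E) (Bijection.to π) v ⇔ S v
    realised = localMaxima-realisable conn {S} [ (_∈? A) , (_∈? B) ]
      (λ {u} {v} → S-independent {u} {v}) S-nonempty
    π : Perm a b
    π = proj₁ realised
    localMax⇔S : ∀ v → LocalMax (Adj E) (Bijection.to π) v ⇔ S v
    localMax⇔S = proj₂ realised

mainTheorem19 : ∀ {a b} (E : BipGraph a b) → Connected E →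
    ∀ (i j : ℕ) → tPositive E i j →
    ∀ (i′ j′ : ℕ) → i′ ≤ i → j′ ≤ j → ¬ (i′ ≡ 0 × j′ ≡ 0) →
    tPositive E i′ j′
mainTheorem19 E conn i j (π₀ , ia≡i , ea≡j) i′ j′ i′≤i j′≤j ¬both
  with A , A⊆A₀ , refl ← subset-of-size (intActiveSet E π₀)
                           (subst (i′ ≤_) (sym (trans (∣intActiveSet∣ E π₀) ia≡i)) i′≤i)
     | B , B⊆B₀ , refl ← subset-of-size (extActiveSet E π₀)
                           (subst (j′ ≤_) (sym (trans (∣extActiveSet∣ E π₀) ea≡j)) j′≤j)
  = nonadjacent-sets-tPositive E conn A B
      (λ i∈A j∈B → activeSets-nonadjacent E π₀ (A⊆A₀ i∈A) (B⊆B₀ j∈B))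
      (nonempty-either A B ¬both)
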